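{- Let $\overline{G}_n$ be a polyphenyl hexagonal chain with $n$ hexagons and let $G_n$ be its hexagonal squeeze. Then $$25\,W(\overline{G}_n)=36\,W(G_n)+150n^3-270n^2-177n.$$
   Context: The Wiener index is $W(G)=\sum_{\{u,v\}\subseteq V(G)} d(u,v)$, with $d$ the shortest-path distance. A polyphenyl hexagonal chain with $n$ hexagons is a graph consisting of pairwise vertex-disjoint hexagons (6-cycles) $\overline{H}_0,\dots,\overline{H}_{n-1}$ together with, for each $1\le k\le n-1$, one cut-edge joining a vertex $c_k$ of $\overline{H}_k$ to a vertex $t_k$ of $\overline{H}_{k-1}$, where $t_k\ne c_{k-1}$ for $k\ge2$. A spiro hexagonal chain with $n$ hexagons is a union of hexagons $H_0,\dots,H_{n-1}$ where $H_{k-1}$ and $H_k$ share exactly one vertex ($1\le k\le n-1$), these shared vertices are distinct, and non-consecutive hexagons are disjoint. The hexagonal squeeze of a polyphenyl hexagonal chain is the spiro hexagonal chain obtained by contracting each of its cut-edges $c_kt_k$ to a single vertex. -}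

module Defs where

open import Data.Nat using (ℕ; zero; suc; _≤_; _+_)
open import Data.Fin using (Fin; zero; suc; toℕ; inject₁; _≟_)
open import Data.Fin.Patterns using (0F; 1F; 2F; 3F; 4F; 5F)
open import Data.Product using (_×_; _,_; Σ; ∃)
open import Data.Sum using (_⊎_)
open import Data.Bool using (Bool; true; false; not)
open import Data.Nat.ListAction using (sum)
open import Data.Empty using (⊥)
open import Data.List using (List; []; _∷_; map; allFin; cartesianProduct; filterᵇ)
open import Relation.Nullary.Decidable using (⌊_⌋)
open import Relation.Binary.PropositionalEquality using (_≡_)

data Walk {V : Set} (E : V → V → Set) : ℕ → V → V → Set where
  here : ∀ {v} → Walk E 0 v v
  step : ∀ {k u w v} → E u w → Walk E k w v → Walk E (suc k) u v

record IsShortestPathDist {V : Set} (S : V → Set) (E : V → V → Set)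
                          (d : V → V → ℕ) : Set where
  field
    attained : ∀ u v → S u → S v → Walk E (d u v) u v
    minimal  : ∀ u v → S u → S v → ∀ k → Walk E k u v → d u v ≤ k

-- Wiener index: sum of d over all unordered pairs of (distinct) entries of
-- a duplicate-free vertex list.
wiener : {V : Set} → (V → V → ℕ) → List V → ℕ
wiener d []       = 0
wiener d (v ∷ vs) = sum (map (d v) vs) + wiener d vs

-- Hexagon chains.  Vertex (k , i) is vertex i (cyclically labelled 0..5)
-- of the k-th hexagon.

V : ℕ → Set
V n = Fin n × Fin 6

allV : (n : ℕ) → List (V n)
allV n = cartesianProduct (allFin n) (allFin 6)

next6 : Fin 6 → Fin 6
next6 0F = 1F
next6 1F = 2F
next6 2F = 3F
next6 3F = 4F
next6 4F = 5F
next6 5F = 0F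

HexAdj : ∀ {n} → V n → V n → Set
HexAdj (k , i) (k' , i') = k ≡ k' × (i' ≡ next6 i ⊎ i ≡ next6 i')

-- Polyphenyl chain with attachment data c t : for 1 ≤ k ≤ n-1 the cut edge
-- joins t k ∈ H_{k-1} with c k ∈ H_k.
CutAdj : ∀ {n} → (c t : ℕ → Fin 6) → V n → V n → Set
CutAdj c t (k , i) (k' , i') =
    (toℕ k' ≡ suc (toℕ k) × i ≡ t (toℕ k') × i' ≡ c (toℕ k'))
  ⊎ (toℕ k ≡ suc (toℕ k') × i' ≡ t (toℕ k) × i ≡ c (toℕ k))

PolyAdj : ∀ {n} → (c t : ℕ → Fin 6) → V n → V n → Set
PolyAdj c t u v = HexAdj u v ⊎ CutAdj c t u v

ValidPolyphenyl : ℕ → (c t : ℕ → Fin 6) → Set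
ValidPolyphenyl n c t = ∀ k → 2 ≤ k → suc k ≤ n → (t k ≡ c (Data.Nat.pred k) → ⊥)

-- Hexagonal squeeze: contract every cut edge c_k t_k.
-- Each contracted class {(k-1 , t k) , (k , c k)} is represented by
-- (k-1 , t k); all other vertices represent themselves.

rep : ∀ {n} → (c t : ℕ → Fin 6) → V n → V n
rep c t (zero , i) = (zero , i)
rep c t (suc k , i) with ⌊ i ≟ c (suc (toℕ k)) ⌋
... | true  = (inject₁ k , t (suc (toℕ k)))
... | false = (suc k , i)

isRep : ∀ {n} → (c t : ℕ → Fin 6) → V n → Bool
isRep c t (zero , i)  = true
isRep c t (suc k , i) = not ⌊ i ≟ c (suc (toℕ k)) ⌋

IsRep : ∀ {n} → (c t : ℕ → Fin 6) → V n → Set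
IsRep c t v = isRep c t v ≡ true

squeezeV : (n : ℕ) → (c t : ℕ → Fin 6) → List (V n)
squeezeV n c t = filterᵇ (isRep c t) (allV n)

SqueezeAdj : ∀ {n} → (c t : ℕ → Fin 6) → V n → V n → Set
SqueezeAdj c t u v =
  Σ _ λ a → Σ _ λ b → HexAdj a b × rep c t a ≡ u × rep c t b ≡ v

module Submission where

-- Both graphs are chains of hexagons indexed by ℕ.  Between two vertices of
-- such a chain there is an explicit candidate distance: go along a shortest
-- arc of each hexagon that is crossed and through each cut edge, where a cut
-- edge has length w = 1 in the polyphenyl chain and length w = 0 in the
-- squeeze (where it is contracted).
--
-- The candidate `ChainDistance.dist` is realised by walks in
--    the graph and drops by at most one along every edge, hence it is the
--    shortest-path distance (`shortestPath≡`).  Adding hexagon m+1 to the first m+1 hexagons, every new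
--    distance factors through the attachment vertex t(m+1), which yields
--    linear recurrences for vertex transmissions and Wiener indices; from
--    them two identities follow by induction (`transmission-identity`,
--    `wiener-identity`), the second being the theorem over ℕ.
--  * Assembly.

open import Defs
open import Data.Nat using (ℕ; zero; suc; _+_; _*_; _∸_; _^_; _≤_; _<_; _⊓_; _%_; z≤n; s≤s; s≤s⁻¹)
import Data.Nat as ℕ
open import Data.Nat.Properties
  using (≤-refl; ≤-trans; ≤-reflexive; ≤-antisym; ≤-total; <-≤-connex; _≤?_; <⇒≤; ⊓-sel; m≤n⇒m≤1+n;
         m≤n+m; suc-injective; +-identityʳ; +-suc; +-assoc; +-comm; +-∸-assoc; m+[n∸m]≡n; n∸n≡0;
         +-monoˡ-≤; +-monoʳ-≤; +-cancelʳ-≡; *-identityʳ; *-assoc; *-zeroʳ; *-suc; *-distribˡ-+)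
open import Data.Nat.ListAction using (sum)
open import Data.Nat.ListAction.Properties using (sum-++)
open import Data.Fin using (Fin; zero; suc; toℕ; inject₁; fromℕ<)
open import Data.Fin.Properties using (all?; toℕ-injective; toℕ<n; toℕ-fromℕ<; toℕ-inject₁)
import Data.Fin.Properties as Fin
open import Data.Product using (_×_; _,_; proj₁)
open import Data.Sum using (_⊎_; inj₁; inj₂)
open import Data.Bool using (Bool; true; false; not)
open import Data.Bool.Properties using (T-≡)
open import Data.List
  using (List; []; _∷_; _++_; [_]; map; length; concat; allFin; tabulate; applyUpTo; filterᵇ; cartesianProduct)
open import Data.List.Properties
  using (map-++; map-∘; map-cong; map-cong-local; length-++; length-map; map-tabulate;
         applyUpTo-∷ʳ; concat-++; concat-[_]; filter-++)
open import Data.List.Relation.Unary.All using (All; []; _∷_; universal)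
import Data.List.Relation.Unary.All as All
open import Data.List.Relation.Unary.All.Properties using (++⁺; map⁺; all-filter; filter⁺)
open import Data.Unit using (⊤; tt)
open import Function using (_∘_; id; Equivalence)
open import Relation.Nullary using (Dec; yes; no; ¬_; contradiction)
open import Relation.Nullary.Decidable using (True; toWitness; ⌊_⌋; T?)
open import Relation.Binary.PropositionalEquality
  using (_≡_; refl; sym; trans; cong; cong₂; subst; subst₂; module ≡-Reasoning)
open ≡-Reasoning
open import Data.Nat.Tactic.RingSolver using (solve-∀)
import Data.Integer as ℤ
open import Data.Integer.Properties using (pos-+; pos-*)
import Data.Integer.Tactic.RingSolver as ℤ-Ring

_++ʷ_ : ∀ {A : Set} {E : A → A → Set} {j k u v s} →
        Walk E j u v → Walk E k v s → Walk E (j + k) u s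
here     ++ʷ q = q
step e p ++ʷ q = step e (p ++ʷ q)

infixr 5 _++ʷ_

castWalk : ∀ {A : Set} {E : A → A → Set} {k k' u u' v v'} →
           k ≡ k' → u ≡ u' → v ≡ v' → Walk E k u v → Walk E k' u' v'
castWalk refl refl refl p = p

mapWalk : ∀ {A B : Set} {E : A → A → Set} {E' : B → B → Set} (f : A → B) →
          (∀ {a b} → E a b → E' (f a) (f b)) →
          ∀ {k u v} → Walk E k u v → Walk E' k (f u) (f v)
mapWalk f edge here       = here
mapWalk f edge (step e p) = step (edge e) (mapWalk f edge p)

reverseWalk : ∀ {A : Set} {E : A → A → Set} → (∀ {a b} → E a b → E b a) →
              ∀ {k u v} → Walk E k u v → Walk E k v u
reverseWalk {E = E} E-sym p = castWalk (+-identityʳ _) refl refl (reverseOnto p here)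
  where
    reverseOnto : ∀ {j k u v s} → Walk E j u v → Walk E k u s → Walk E (j + k) v s
    reverseOnto here acc = acc
    reverseOnto {suc j} {k} (step e p) acc =
      castWalk (+-suc j k) refl refl (reverseOnto p (step (E-sym e) acc))

potential≤length : ∀ {A : Set} {E : A → A → Set} (F : A → ℕ) {v} → F v ≡ 0 →
                   (∀ {a b} → E a b → F a ≤ suc (F b)) →
                   ∀ {k u} → Walk E k u v → F u ≤ k
potential≤length F Fv≡0 lip here       = ≤-reflexive Fv≡0
potential≤length F Fv≡0 lip (step e p) = ≤-trans (lip e) (s≤s (potential≤length F Fv≡0 lip p))

shortestPath≡ : ∀ {A : Set} {S : A → Set} {E : A → A → Set} {d : A → A → ℕ} →
                IsShortestPathDist S E d → (D : A → A → ℕ) →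
                (∀ u v → S u → S v → Walk E (D u v) u v) →
                (∀ v → D v v ≡ 0) →
                (∀ v {a b} → E a b → D a v ≤ suc (D b v)) →
                ∀ u v → S u → S v → d u v ≡ D u v
shortestPath≡ sp D walk diag lip u v Su Sv =
  ≤-antisym (minimal u v Su Sv (D u v) (walk u v Su Sv))
            (potential≤length (λ a → D a v) (diag v) (lip v) (attained u v Su Sv))
  where open IsShortestPathDist sp

sum-map-++ : ∀ {A : Set} (f : A → ℕ) xs ys →
             sum (map f (xs ++ ys)) ≡ sum (map f xs) + sum (map f ys)
sum-map-++ f xs ys = trans (cong sum (map-++ f xs ys)) (sum-++ (map f xs) (map f ys))

sum-map-+ : ∀ {A : Set} (f g : A → ℕ) xs →
            sum (map (λ a → f a + g a) xs) ≡ sum (map f xs) + sum (map g xs)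
sum-map-+ f g []       = refl
sum-map-+ f g (x ∷ xs) = trans (cong (f x + g x +_) (sum-map-+ f g xs))
                               (interchange (f x) (g x) _ _)
  where
    interchange : ∀ a b c d → a + b + (c + d) ≡ a + c + (b + d)
    interchange = solve-∀

sum-map-const : ∀ {A : Set} k (xs : List A) → sum (map (λ _ → k) xs) ≡ length xs * k
sum-map-const k []       = refl
sum-map-const k (x ∷ xs) = cong (k +_) (sum-map-const k xs)

sum-map-scale : ∀ {A : Set} k (f : A → ℕ) xs → sum (map (λ a → k * f a) xs) ≡ k * sum (map f xs)
sum-map-scale k f []       = sym (*-zeroʳ k)
sum-map-scale k f (x ∷ xs) =
  trans (cong (k * f x +_) (sum-map-scale k f xs)) (sym (*-distribˡ-+ k (f x) _))

sum-map-shift : ∀ {A : Set} (f : A → ℕ) K xs →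
                sum (map (λ a → f a + K) xs) ≡ sum (map f xs) + length xs * K
sum-map-shift f K xs = trans (sum-map-+ f (λ _ → K) xs) (cong (sum (map f xs) +_) (sum-map-const K xs))

sum-sum-separable : ∀ {A B : Set} (f : A → ℕ) (g : B → ℕ) xs ys →
  sum (map (λ a → sum (map (λ b → f a + g b) ys)) xs)
    ≡ length ys * sum (map f xs) + length xs * sum (map g ys)
sum-sum-separable f g xs ys = begin
    sum (map (λ a → sum (map (λ b → f a + g b) ys)) xs)
  ≡⟨ cong sum (map-cong inner xs) ⟩
    sum (map (λ a → length ys * f a + G) xs)
  ≡⟨ sum-map-shift (λ a → length ys * f a) G xs ⟩
    sum (map (λ a → length ys * f a) xs) + length xs * G
  ≡⟨ cong (_+ length xs * G) (sum-map-scale (length ys) f xs) ⟩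
    length ys * sum (map f xs) + length xs * G
  ∎
  where
    G = sum (map g ys)
    inner : ∀ a → sum (map (λ b → f a + g b) ys) ≡ length ys * f a + G
    inner a = trans (sum-map-+ (λ _ → f a) g ys) (cong (_+ G) (sum-map-const (f a) ys))

wiener-++ : ∀ {A : Set} (d : A → A → ℕ) xs ys →
  wiener d (xs ++ ys) ≡ wiener d xs + sum (map (λ a → sum (map (d a) ys)) xs) + wiener d ys
wiener-++ d []       ys = refl
wiener-++ d (x ∷ xs) ys = begin
    sum (map (d x) (xs ++ ys)) + wiener d (xs ++ ys)
  ≡⟨ cong₂ _+_ (sum-map-++ (d x) xs ys) (wiener-++ d xs ys) ⟩
    sum (map (d x) xs) + sum (map (d x) ys) + (wiener d xs + C + wiener d ys)
  ≡⟨ regroup (sum (map (d x) xs)) (sum (map (d x) ys)) (wiener d xs) C (wiener d ys) ⟩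
    sum (map (d x) xs) + wiener d xs + (sum (map (d x) ys) + C) + wiener d ys
  ∎
  where
    C = sum (map (λ a → sum (map (d a) ys)) xs)
    regroup : ∀ a b c e f → a + b + (c + e + f) ≡ a + c + (b + e) + f
    regroup = solve-∀

wiener-map : ∀ {A B : Set} (d : B → B → ℕ) (f : A → B) xs →
             wiener d (map f xs) ≡ wiener (λ a b → d (f a) (f b)) xs
wiener-map d f []       = refl
wiener-map d f (x ∷ xs) = cong₂ _+_ (cong sum (sym (map-∘ xs))) (wiener-map d f xs)

wiener-congˡ : ∀ {A : Set} {P : A → Set} {d d' : A → A → ℕ} {xs} → All P xs →
               (∀ {a b} → P a → P b → d a b ≡ d' a b) → wiener d xs ≡ wiener d' xs
wiener-congˡ []       eq = refl
wiener-congˡ (p ∷ ps) eq =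
  cong₂ _+_ (cong sum (map-cong-local (All.map (eq p) ps))) (wiener-congˡ ps eq)

wiener-cong : ∀ {A : Set} {d d' : A → A → ℕ} → (∀ a b → d a b ≡ d' a b) →
              ∀ xs → wiener d xs ≡ wiener d' xs
wiener-cong eq xs = wiener-congˡ (universal (λ _ → tt) xs) (λ {a} {b} _ _ → eq a b)

map-filterᵇ : ∀ {A B : Set} (p : A → Bool) (q : B → Bool) (f : A → B) →
              (∀ a → p a ≡ q (f a)) → ∀ xs → map f (filterᵇ p xs) ≡ filterᵇ q (map f xs)
map-filterᵇ p q f pq []       = refl
map-filterᵇ p q f pq (x ∷ xs) with p x | q (f x) | pq x
... | true  | .true  | refl = cong (f x ∷_) (map-filterᵇ p q f pq xs)
... | false | .false | refl = map-filterᵇ p q f pq xs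

every : {P : Fin 6 → Set} (P? : ∀ x → Dec (P x)) → {True (all? P?)} → ∀ x → P x
every P? {ok} = toWitness ok

every² : {P : Fin 6 → Fin 6 → Set} (P? : ∀ x y → Dec (P x y)) →
         {True (all? λ x → all? (P? x))} → ∀ x y → P x y
every² P? {ok} = toWitness ok

-- number of forward steps (along next6) from x to y
arc : Fin 6 → Fin 6 → ℕ
arc x y = (6 + toℕ y ∸ toℕ x) % 6

hexDist : Fin 6 → Fin 6 → ℕ
hexDist x y = arc x y ⊓ arc y x

stepsForward : ℕ → Fin 6 → Fin 6
stepsForward zero    x = x
stepsForward (suc g) x = stepsForward g (next6 x)

CycleAdj : Fin 6 → Fin 6 → Set
CycleAdj x x' = x' ≡ next6 x ⊎ x ≡ next6 x'

arc-reaches : ∀ x y → stepsForward (arc x y) x ≡ y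
arc-reaches = every² λ x y → stepsForward (arc x y) x Fin.≟ y

hexDist-self : ∀ x → hexDist x x ≡ 0
hexDist-self = every λ x → hexDist x x ℕ.≟ 0

hexDist-sym : ∀ x y → hexDist x y ≡ hexDist y x
hexDist-sym = every² λ x y → hexDist x y ℕ.≟ hexDist y x

hexDist-lipˡ : ∀ {x x'} z → CycleAdj x x' → hexDist x z ≤ suc (hexDist x' z)
hexDist-lipˡ z (inj₁ refl) = every² (λ x z → hexDist x z ℕ.≤? suc (hexDist (next6 x) z)) _ z
hexDist-lipˡ z (inj₂ refl) = every² (λ x z → hexDist (next6 x) z ℕ.≤? suc (hexDist x z)) _ z

hexDist-lipʳ : ∀ x {y y'} → CycleAdj y y' → hexDist x y ≤ suc (hexDist x y')
hexDist-lipʳ x {y} {y'} adj =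
  subst₂ (λ p q → p ≤ suc q) (hexDist-sym y x) (hexDist-sym y' x) (hexDist-lipˡ x adj)

-- the vertices of a hexagon other than u; in the squeeze these remain
-- when the hexagon is attached at u
others : Fin 6 → List (Fin 6)
others u = filterᵇ (λ x → not ⌊ x Fin.≟ u ⌋) (allFin 6)

hexagon-column : ∀ z → sum (map (λ x → hexDist x z) (allFin 6)) ≡ 9
hexagon-column = every λ z → _ ℕ.≟ 9

hexagon-row⁺ : ∀ u → sum (map (λ y → 1 + hexDist u y) (allFin 6)) ≡ 15
hexagon-row⁺ = every λ u → _ ℕ.≟ 15

hexagon-wiener : wiener hexDist (allFin 6) ≡ 27
hexagon-wiener = refl

others-length : ∀ u → length (others u) ≡ 5
others-length = every λ u → _ ℕ.≟ 5

others-row : ∀ u → sum (map (hexDist u) (others u)) ≡ 9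
others-row = every λ u → _ ℕ.≟ 9

others-column : ∀ u z → sum (map (λ x → hexDist x z) (others u)) + hexDist u z ≡ 9
others-column = every² λ u z → _ ℕ.≟ 9

others-wiener : ∀ u → wiener hexDist (others u) ≡ 18
others-wiener = every λ u → _ ℕ.≟ 18

HexAdj-sym : ∀ {n} {a b : V n} → HexAdj a b → HexAdj b a
HexAdj-sym (refl , inj₁ e) = refl , inj₂ e
HexAdj-sym (refl , inj₂ e) = refl , inj₁ e

forwardWalk : ∀ {n} (k : Fin n) g x → Walk HexAdj g (k , x) (k , stepsForward g x)
forwardWalk k zero    x = here
forwardWalk k (suc g) x = step (refl , inj₁ refl) (forwardWalk k g (next6 x))

hexWalk : ∀ {n} (k : Fin n) x y → Walk HexAdj (hexDist x y) (k , x) (k , y)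
hexWalk k x y with ⊓-sel (arc x y) (arc y x)
... | inj₁ eq = castWalk (sym eq) refl (cong (k ,_) (arc-reaches x y)) (forwardWalk k (arc x y) x)
... | inj₂ eq = castWalk (sym eq) (cong (k ,_) (arc-reaches y x)) refl
                         (reverseWalk HexAdj-sym (forwardWalk k (arc y x) y))

Vℕ : Set
Vℕ = ℕ × Fin 6

onHexagon : ℕ → List (Fin 6) → List Vℕ
onHexagon i ys = map (i ,_) ys

DifferBy : ℕ → ℕ → ℕ → Set
DifferBy w p q = p ≡ w + q ⊎ q ≡ w + p

differBy⇒≤ : ∀ {w p q} → DifferBy w p q → p ≤ w + q
differBy⇒≤ (inj₁ p≡w+q)         = ≤-reflexive p≡w+q
differBy⇒≤ {w} {p} (inj₂ refl) = ≤-trans (m≤n+m p w) (m≤n+m (w + p) w)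

differBy-sym : ∀ {w p q} → DifferBy w p q → DifferBy w q p
differBy-sym (inj₁ e) = inj₂ e
differBy-sym (inj₂ e) = inj₁ e

differBy-zero : ∀ {p q} → DifferBy 0 p q → p ≡ q
differBy-zero (inj₁ e) = e
differBy-zero (inj₂ e) = sym e

-- The chain with attachment data c t (hexagon k+1 is attached to vertex
-- t (k+1) of hexagon k at its vertex c (k+1)) and cut edges of length w.
module ChainDistance (c t : ℕ → Fin 6) (w : ℕ) where

  -- ascent i x g y: length of the route from (i , x) to (i + g , y) that
  -- crosses every hexagon on a shortest arc and every cut edge once
  ascent : ℕ → Fin 6 → ℕ → Fin 6 → ℕ
  ascent i x zero    y = hexDist x y
  ascent i x (suc g) y = ascent i x g (t (suc (i + g))) + (w + hexDist (c (suc (i + g))) y)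

  dist : Vℕ → Vℕ → ℕ
  dist (i , x) (j , y) with i ≤? j
  ... | yes _ = ascent i x (j ∸ i) y
  ... | no  _ = ascent j y (i ∸ j) x

  dist-≤ : ∀ {i j} x y → i ≤ j → dist (i , x) (j , y) ≡ ascent i x (j ∸ i) y
  dist-≤ {i} {j} x y i≤j with i ≤? j
  ... | yes _   = refl
  ... | no  i≰j = contradiction i≤j i≰j

  dist-≥ : ∀ {i j} x y → j ≤ i → dist (i , x) (j , y) ≡ ascent j y (i ∸ j) x
  dist-≥ {i} {j} x y j≤i with i ≤? j
  ... | no  _   = refl
  ... | yes i≤j with ≤-antisym i≤j j≤i
  ...   | refl rewrite n∸n≡0 i = hexDist-sym x y

  dist-same : ∀ i x y → dist (i , x) (i , y) ≡ hexDist x y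
  dist-same i x y = trans (dist-≤ {i} x y ≤-refl) (cong (λ g → ascent i x g y) (n∸n≡0 i))

  dist-diag : ∀ v → dist v v ≡ 0
  dist-diag (i , x) = trans (dist-same i x x) (hexDist-self x)

  ascent-step : ∀ {i m} x y → i ≤ m →
    ascent i x (suc m ∸ i) y ≡ ascent i x (m ∸ i) (t (suc m)) + (w + hexDist (c (suc m)) y)
  ascent-step {i} {m} x y i≤m rewrite +-∸-assoc 1 i≤m | m+[n∸m]≡n i≤m = refl

  dist-step : ∀ m y {a} → proj₁ a ≤ m →
    dist a (suc m , y) ≡ dist a (m , t (suc m)) + (w + hexDist (c (suc m)) y)
  dist-step m y {i , x} i≤m = begin
      dist (i , x) (suc m , y)
    ≡⟨ dist-≤ x y (m≤n⇒m≤1+n i≤m) ⟩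
      ascent i x (suc m ∸ i) y
    ≡⟨ ascent-step x y i≤m ⟩
      ascent i x (m ∸ i) (t (suc m)) + (w + hexDist (c (suc m)) y)
    ≡⟨ cong (_+ (w + hexDist (c (suc m)) y)) (sym (dist-≤ x (t (suc m)) i≤m)) ⟩
      dist (i , x) (m , t (suc m)) + (w + hexDist (c (suc m)) y)
    ∎

  ascent-cut : ∀ i g y → ascent i (t (suc i)) (suc g) y ≡ w + ascent (suc i) (c (suc i)) g y
  ascent-cut i zero y rewrite +-identityʳ i | hexDist-self (t (suc i)) = refl
  ascent-cut i (suc g) y rewrite +-suc i g | ascent-cut i g (t (suc (suc (i + g)))) =
    +-assoc w _ _

  dist-cut : ∀ i v → DifferBy w (dist (i , t (suc i)) v) (dist (suc i , c (suc i)) v)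
  dist-cut i (j , y) with <-≤-connex i j
  ... | inj₁ i<j = inj₁ (begin
      dist (i , t (suc i)) (j , y)
    ≡⟨ dist-≤ _ y (<⇒≤ i<j) ⟩
      ascent i (t (suc i)) (j ∸ i) y
    ≡⟨ cong (λ g → ascent i (t (suc i)) g y) (+-∸-assoc 1 i<j) ⟩
      ascent i (t (suc i)) (suc (j ∸ suc i)) y
    ≡⟨ ascent-cut i (j ∸ suc i) y ⟩
      w + ascent (suc i) (c (suc i)) (j ∸ suc i) y
    ≡⟨ cong (w +_) (sym (dist-≤ _ y i<j)) ⟩
      w + dist (suc i , c (suc i)) (j , y)
    ∎)
  ... | inj₂ j≤i = inj₂ (begin
      dist (suc i , c (suc i)) (j , y)
    ≡⟨ dist-≥ _ y (m≤n⇒m≤1+n j≤i) ⟩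
      ascent j y (suc i ∸ j) (c (suc i))
    ≡⟨ ascent-step y (c (suc i)) j≤i ⟩
      ascent j y (i ∸ j) (t (suc i)) + (w + hexDist (c (suc i)) (c (suc i)))
    ≡⟨ cong (λ h → ascent j y (i ∸ j) (t (suc i)) + (w + h)) (hexDist-self (c (suc i))) ⟩
      ascent j y (i ∸ j) (t (suc i)) + (w + 0)
    ≡⟨ cong₂ _+_ (sym (dist-≥ _ y j≤i)) (+-identityʳ w) ⟩
      dist (i , t (suc i)) (j , y) + w
    ≡⟨ +-comm _ w ⟩
      w + dist (i , t (suc i)) (j , y)
    ∎)

  ascent-lipˡ : ∀ i {x x'} g y → CycleAdj x x' → ascent i x g y ≤ suc (ascent i x' g y)
  ascent-lipˡ i zero    y adj = hexDist-lipˡ y adj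
  ascent-lipˡ i (suc g) y adj = +-monoˡ-≤ _ (ascent-lipˡ i g _ adj)

  ascent-lipʳ : ∀ i x g {y y'} → CycleAdj y y' → ascent i x g y ≤ suc (ascent i x g y')
  ascent-lipʳ i x zero    adj = hexDist-lipʳ x adj
  ascent-lipʳ i x (suc g) {y} {y'} adj = ≤-trans
    (+-monoʳ-≤ A (+-monoʳ-≤ w (hexDist-lipʳ (c (suc (i + g))) adj)))
    (≤-reflexive (trans (cong (A +_) (+-suc w _)) (+-suc A _)))
    where A = ascent i x g (t (suc (i + g)))

  dist-hexLip : ∀ i {x x'} v → CycleAdj x x' → dist (i , x) v ≤ suc (dist (i , x') v)
  dist-hexLip i {x} {x'} (j , y) adj with ≤-total i j
  ... | inj₁ i≤j rewrite dist-≤ x y i≤j | dist-≤ x' y i≤j = ascent-lipˡ i (j ∸ i) y adj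
  ... | inj₂ j≤i rewrite dist-≥ x y j≤i | dist-≥ x' y j≤i = ascent-lipʳ j y (i ∸ j) adj

  sum-within : ∀ i z (ys : List (Fin 6)) →
    sum (map (λ a → dist a (i , z)) (onHexagon i ys)) ≡ sum (map (λ x → hexDist x z) ys)
  sum-within i z ys = cong sum (trans (sym (map-∘ ys)) (map-cong (λ x → dist-same i x z) ys))

  wiener-within : ∀ i (ys : List (Fin 6)) → wiener dist (onHexagon i ys) ≡ wiener hexDist ys
  wiener-within i ys = trans (wiener-map dist (i ,_) ys) (wiener-cong (dist-same i) ys)

  sum-dist-step : ∀ m y {xs} → All (λ a → proj₁ a ≤ m) xs →
    sum (map (λ a → dist a (suc m , y)) xs)
      ≡ sum (map (λ a → dist a (m , t (suc m))) xs) + length xs * (w + hexDist (c (suc m)) y)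
  sum-dist-step m y {xs} below =
    trans (cong sum (map-cong-local (All.map (dist-step m y) below)))
          (sum-map-shift (λ a → dist a (m , t (suc m))) _ xs)

  cross-step : ∀ m {xs} → All (λ a → proj₁ a ≤ m) xs → ∀ ys →
    sum (map (λ a → sum (map (dist a) (onHexagon (suc m) ys))) xs)
      ≡ length ys * sum (map (λ a → dist a (m , t (suc m))) xs)
        + length xs * sum (map (λ y → w + hexDist (c (suc m)) y) ys)
  cross-step m {xs} below ys = begin
      sum (map (λ a → sum (map (dist a) (onHexagon (suc m) ys))) xs)
    ≡⟨ cong sum (map-cong-local (All.map split below)) ⟩
      sum (map (λ a → sum (map (λ y → dist a (m , t (suc m)) + (w + hexDist (c (suc m)) y)) ys)) xs)
    ≡⟨ sum-sum-separable (λ a → dist a (m , t (suc m))) (λ y → w + hexDist (c (suc m)) y) xs ys ⟩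
      length ys * sum (map (λ a → dist a (m , t (suc m))) xs)
        + length xs * sum (map (λ y → w + hexDist (c (suc m)) y) ys)
    ∎
    where
      split : ∀ {a} → proj₁ a ≤ m → sum (map (dist a) (onHexagon (suc m) ys))
                ≡ sum (map (λ y → dist a (m , t (suc m)) + (w + hexDist (c (suc m)) y)) ys)
      split below-a = cong sum (trans (sym (map-∘ ys)) (map-cong (λ y → dist-step m y below-a) ys))

hexagon : ℕ → List Vℕ
hexagon i = onHexagon i (allFin 6)

hexagons : ℕ → List Vℕ
hexagons m = concat (applyUpTo hexagon m)

hexagons-suc : ∀ m → hexagons (suc m) ≡ hexagons m ++ hexagon m
hexagons-suc m = begin
    concat (applyUpTo hexagon (suc m))
  ≡⟨ cong concat (sym (applyUpTo-∷ʳ hexagon m)) ⟩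
    concat (applyUpTo hexagon m ++ [ hexagon m ])
  ≡⟨ sym (concat-++ (applyUpTo hexagon m) [ hexagon m ]) ⟩
    hexagons m ++ concat [ hexagon m ]
  ≡⟨ cong (hexagons m ++_) concat-[ hexagon m ] ⟩
    hexagons m ++ hexagon m
  ∎

hexagons-below : ∀ m → All (λ a → proj₁ a < m) (hexagons m)
hexagons-below zero    = []
hexagons-below (suc m) = subst (All _) (sym (hexagons-suc m))
  (++⁺ (All.map m≤n⇒m≤1+n (hexagons-below m))
       (map⁺ {P = λ a → proj₁ a < suc m} {f = m ,_} (universal (λ _ → ≤-refl) (allFin 6))))

length-hexagons : ∀ m → length (hexagons m) ≡ 6 * m
length-hexagons zero    = refl
length-hexagons (suc m) = begin
    length (hexagons (suc m))
  ≡⟨ cong length (hexagons-suc m) ⟩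
    length (hexagons m ++ hexagon m)
  ≡⟨ length-++ (hexagons m) ⟩
    length (hexagons m) + 6
  ≡⟨ cong (_+ 6) (length-hexagons m) ⟩
    6 * m + 6
  ≡⟨ +-comm (6 * m) 6 ⟩
    6 + 6 * m
  ≡⟨ *-suc 6 m ⟨
    6 * suc m
  ∎

-- A vertex survives the squeeze unless it is the vertex c i by which a
-- hexagon i ≥ 1 is attached; that vertex is identified with t i.
survives : (ℕ → Fin 6) → Vℕ → Bool
survives c (zero  , x) = true
survives c (suc i , x) = not ⌊ x Fin.≟ c (suc i) ⌋

squeezed : (ℕ → Fin 6) → ℕ → List Vℕ
squeezed c m = filterᵇ (survives c) (hexagons m)

squeezed-suc : ∀ c m →
  squeezed c (suc (suc m)) ≡ squeezed c (suc m) ++ onHexagon (suc m) (others (c (suc m)))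
squeezed-suc c m = begin
    filterᵇ (survives c) (hexagons (suc (suc m)))
  ≡⟨ cong (filterᵇ (survives c)) (hexagons-suc (suc m)) ⟩
    filterᵇ (survives c) (hexagons (suc m) ++ hexagon (suc m))
  ≡⟨ filter-++ (T? ∘ survives c) (hexagons (suc m)) (hexagon (suc m)) ⟩
    squeezed c (suc m) ++ filterᵇ (survives c) (hexagon (suc m))
  ≡⟨ cong (squeezed c (suc m) ++_)
          (sym (map-filterᵇ _ (survives c) (suc m ,_) (λ _ → refl) (allFin 6))) ⟩
    squeezed c (suc m) ++ onHexagon (suc m) (others (c (suc m)))
  ∎

squeezed-below : ∀ c m → All (λ a → proj₁ a < m) (squeezed c m)
squeezed-below c m = filter⁺ (T? ∘ survives c) (hexagons-below m)

length-squeezed : ∀ c m → length (squeezed c (suc m)) ≡ 5 * m + 6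
length-squeezed c zero    = refl
length-squeezed c (suc m) = begin
    length (squeezed c (suc (suc m)))
  ≡⟨ cong length (squeezed-suc c m) ⟩
    length (squeezed c (suc m) ++ onHexagon (suc m) (others (c (suc m))))
  ≡⟨ length-++ (squeezed c (suc m)) ⟩
    length (squeezed c (suc m)) + length (onHexagon (suc m) (others (c (suc m))))
  ≡⟨ cong₂ _+_ (length-squeezed c m)
               (trans (length-map {A = Fin 6} {B = Vℕ} (suc m ,_) (others (c (suc m))))
                      (others-length (c (suc m)))) ⟩
    5 * m + 6 + 5
  ≡⟨ arith m ⟩
    5 * suc m + 6
  ∎
  where
    arith : ∀ m → 5 * m + 6 + 5 ≡ 5 * suc m + 6
    arith = solve-∀

module ChainWiener (c t : ℕ → Fin 6) where
  module P = ChainDistance c t 1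
  module S = ChainDistance c t 0

  Tp Ts : ℕ → Fin 6 → ℕ
  Tp m z = sum (map (λ a → P.dist a (m , z)) (hexagons (suc m)))
  Ts m z = sum (map (λ a → S.dist a (m , z)) (squeezed c (suc m)))

  Wp Ws : ℕ → ℕ
  Wp n = wiener P.dist (hexagons n)
  Ws n = wiener S.dist (squeezed c n)

  hexagons-earlier : ∀ m → All (λ a → proj₁ a ≤ m) (hexagons (suc m))
  hexagons-earlier m = All.map s≤s⁻¹ (hexagons-below (suc m))

  squeezed-earlier : ∀ m → All (λ a → proj₁ a ≤ m) (squeezed c (suc m))
  squeezed-earlier m = All.map s≤s⁻¹ (squeezed-below c (suc m))

  -- Recurrences: hexagon m+1 is reached from the earlier vertices through
  -- the cut edge at t (m+1).
  Tp-zero : ∀ z → Tp 0 z ≡ 9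
  Tp-zero = hexagon-column

  Ts-zero : ∀ z → Ts 0 z ≡ 9
  Ts-zero = hexagon-column

  Tp-suc : ∀ m z → Tp (suc m) z ≡ Tp m (t (suc m)) + 6 * suc m * (1 + hexDist (c (suc m)) z) + 9
  Tp-suc m z = begin
      sum (map f (hexagons (suc (suc m))))
    ≡⟨ cong (sum ∘ map f) (hexagons-suc (suc m)) ⟩
      sum (map f (hexagons (suc m) ++ hexagon (suc m)))
    ≡⟨ sum-map-++ f (hexagons (suc m)) (hexagon (suc m)) ⟩
      sum (map f (hexagons (suc m))) + sum (map f (hexagon (suc m)))
    ≡⟨ cong₂ _+_ (P.sum-dist-step m z (hexagons-earlier m))
                 (trans (P.sum-within (suc m) z (allFin 6)) (hexagon-column z)) ⟩
      Tp m (t (suc m)) + length (hexagons (suc m)) * (1 + H) + 9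
    ≡⟨ cong (λ l → Tp m (t (suc m)) + l * (1 + H) + 9) (length-hexagons (suc m)) ⟩
      Tp m (t (suc m)) + 6 * suc m * (1 + H) + 9
    ∎
    where
      f = λ a → P.dist a (suc m , z)
      H = hexDist (c (suc m)) z

  -- (the squeeze lacks the vertex c (m+1), whose distance is added on the left)
  Ts-suc : ∀ m z → Ts (suc m) z + hexDist (c (suc m)) z
                   ≡ Ts m (t (suc m)) + (5 * m + 6) * hexDist (c (suc m)) z + 9
  Ts-suc m z = begin
      sum (map f (squeezed c (suc (suc m)))) + H
    ≡⟨ cong (λ xs → sum (map f xs) + H) (squeezed-suc c m) ⟩
      sum (map f (squeezed c (suc m) ++ new)) + H
    ≡⟨ cong (_+ H) (sum-map-++ f (squeezed c (suc m)) new) ⟩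
      sum (map f (squeezed c (suc m))) + sum (map f new) + H
    ≡⟨ +-assoc (sum (map f (squeezed c (suc m)))) _ H ⟩
      sum (map f (squeezed c (suc m))) + (sum (map f new) + H)
    ≡⟨ cong₂ _+_ (S.sum-dist-step m z (squeezed-earlier m))
                 (trans (cong (_+ H) (S.sum-within (suc m) z (others (c (suc m)))))
                        (others-column (c (suc m)) z)) ⟩
      Ts m (t (suc m)) + length (squeezed c (suc m)) * H + 9
    ≡⟨ cong (λ l → Ts m (t (suc m)) + l * H + 9) (length-squeezed c m) ⟩
      Ts m (t (suc m)) + (5 * m + 6) * H + 9
    ∎
    where
      f = λ a → S.dist a (suc m , z)
      H = hexDist (c (suc m)) z
      new = onHexagon (suc m) (others (c (suc m)))

  Wp-suc : ∀ m → Wp (suc (suc m)) ≡ Wp (suc m) + (6 * Tp m (t (suc m)) + 6 * suc m * 15) + 27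
  Wp-suc m = begin
      wiener P.dist (hexagons (suc (suc m)))
    ≡⟨ cong (wiener P.dist) (hexagons-suc (suc m)) ⟩
      wiener P.dist (hexagons (suc m) ++ hexagon (suc m))
    ≡⟨ wiener-++ P.dist (hexagons (suc m)) (hexagon (suc m)) ⟩
      Wp (suc m) + sum (map (λ a → sum (map (P.dist a) (hexagon (suc m)))) (hexagons (suc m)))
        + wiener P.dist (hexagon (suc m))
    ≡⟨ cong₂ (λ cross block → Wp (suc m) + cross + block)
             (P.cross-step m (hexagons-earlier m) (allFin 6))
             (trans (P.wiener-within (suc m) (allFin 6)) hexagon-wiener) ⟩
      Wp (suc m) + (6 * Tp m (t (suc m)) + length (hexagons (suc m)) * row) + 27
    ≡⟨ cong₂ (λ l s → Wp (suc m) + (6 * Tp m (t (suc m)) + l * s) + 27)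
             (length-hexagons (suc m)) (hexagon-row⁺ (c (suc m))) ⟩
      Wp (suc m) + (6 * Tp m (t (suc m)) + 6 * suc m * 15) + 27
    ∎
    where row = sum (map (λ y → 1 + hexDist (c (suc m)) y) (allFin 6))

  Ws-suc : ∀ m → Ws (suc (suc m)) ≡ Ws (suc m) + (5 * Ts m (t (suc m)) + (5 * m + 6) * 9) + 18
  Ws-suc m = begin
      wiener S.dist (squeezed c (suc (suc m)))
    ≡⟨ cong (wiener S.dist) (squeezed-suc c m) ⟩
      wiener S.dist (squeezed c (suc m) ++ new)
    ≡⟨ wiener-++ S.dist (squeezed c (suc m)) new ⟩
      Ws (suc m) + sum (map (λ a → sum (map (S.dist a) new)) (squeezed c (suc m))) + wiener S.dist new
    ≡⟨ cong₂ (λ cross block → Ws (suc m) + cross + block)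
             (S.cross-step m (squeezed-earlier m) (others u))
             (trans (S.wiener-within (suc m) (others u)) (others-wiener u)) ⟩
      Ws (suc m) + (length (others u) * Ts m (t (suc m))
                    + length (squeezed c (suc m)) * row) + 18
    ≡⟨ cong₂ (λ k l → Ws (suc m) + (k * Ts m (t (suc m)) + l * row) + 18)
             (others-length u) (length-squeezed c m) ⟩
      Ws (suc m) + (5 * Ts m (t (suc m)) + (5 * m + 6) * row) + 18
    ≡⟨ cong (λ s → Ws (suc m) + (5 * Ts m (t (suc m)) + (5 * m + 6) * s) + 18) (others-row u) ⟩
      Ws (suc m) + (5 * Ts m (t (suc m)) + (5 * m + 6) * 9) + 18
    ∎
    where
      u = c (suc m)
      new = onHexagon (suc m) (others u)
      row = sum (map (hexDist u) (others u))

  transmission-identity : ∀ m z → 5 * Tp m z + 9 ≡ 6 * Ts m z + 15 * m * m + 6 * m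
  transmission-identity zero z =
    trans (cong (λ p → 5 * p + 9) (Tp-zero z)) (cong (λ q → 6 * q + 0 + 0) (sym (Ts-zero z)))
  transmission-identity (suc m) z = +-cancelʳ-≡ (6 * H) _ _ (begin
      5 * Tp (suc m) z + 9 + 6 * H
    ≡⟨ cong (λ p → 5 * p + 9 + 6 * H) (Tp-suc m z) ⟩
      5 * (A + 6 * suc m * (1 + H) + 9) + 9 + 6 * H
    ≡⟨ expand₁ A m H ⟩
      (5 * A + 9) + (30 * suc m * suc H + 45 + 6 * H)
    ≡⟨ cong (_+ (30 * suc m * suc H + 45 + 6 * H)) (transmission-identity m (t (suc m))) ⟩
      (6 * B + 15 * m * m + 6 * m) + (30 * suc m * suc H + 45 + 6 * H)
    ≡⟨ expand₂ B m H ⟩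
      6 * (B + (5 * m + 6) * H + 9) + 15 * suc m * suc m + 6 * suc m
    ≡⟨ cong (λ q → 6 * q + 15 * suc m * suc m + 6 * suc m) (Ts-suc m z) ⟨
      6 * (Ts (suc m) z + H) + 15 * suc m * suc m + 6 * suc m
    ≡⟨ expand₃ (Ts (suc m) z) m H ⟩
      6 * Ts (suc m) z + 15 * suc m * suc m + 6 * suc m + 6 * H
    ∎)
    where
      H = hexDist (c (suc m)) z
      A = Tp m (t (suc m))
      B = Ts m (t (suc m))
      expand₁ : ∀ A m H → 5 * (A + 6 * suc m * (1 + H) + 9) + 9 + 6 * H
                          ≡ (5 * A + 9) + (30 * suc m * suc H + 45 + 6 * H)
      expand₁ = solve-∀
      expand₂ : ∀ B m H → (6 * B + 15 * m * m + 6 * m) + (30 * suc m * suc H + 45 + 6 * H)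
                          ≡ 6 * (B + (5 * m + 6) * H + 9) + 15 * suc m * suc m + 6 * suc m
      expand₂ = solve-∀
      expand₃ : ∀ Q m H → 6 * (Q + H) + 15 * suc m * suc m + 6 * suc m
                          ≡ 6 * Q + 15 * suc m * suc m + 6 * suc m + 6 * H
      expand₃ = solve-∀

  wiener-identity : ∀ n → 25 * Wp n + 270 * (n * n) + 177 * n ≡ 36 * Ws n + 150 * (n * n * n)
  wiener-identity zero          = refl
  wiener-identity (suc zero)    = refl
  wiener-identity (suc (suc m)) = begin
      25 * Wp (suc (suc m)) + 270 * (suc (suc m) * suc (suc m)) + 177 * suc (suc m)
    ≡⟨ cong (λ W → 25 * W + 270 * (suc (suc m) * suc (suc m)) + 177 * suc (suc m)) (Wp-suc m) ⟩
      25 * (Wp (suc m) + (6 * A + 6 * suc m * 15) + 27) + 270 * (suc (suc m) * suc (suc m)) + 177 * suc (suc m)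
    ≡⟨ expand₁ (Wp (suc m)) A m ⟩
      (25 * Wp (suc m) + 270 * (suc m * suc m) + 177 * suc m) + 30 * (5 * A + 9) + (2790 * m + 3642)
    ≡⟨ cong₂ (λ p q → p + 30 * q + (2790 * m + 3642))
             (wiener-identity (suc m)) (transmission-identity m (t (suc m))) ⟩
      (36 * Ws (suc m) + 150 * (suc m * suc m * suc m)) + 30 * (6 * B + 15 * m * m + 6 * m) + (2790 * m + 3642)
    ≡⟨ expand₂ (Ws (suc m)) B m ⟩
      36 * (Ws (suc m) + (5 * B + (5 * m + 6) * 9) + 18) + 150 * (suc (suc m) * suc (suc m) * suc (suc m))
    ≡⟨ cong (λ W → 36 * W + 150 * (suc (suc m) * suc (suc m) * suc (suc m))) (Ws-suc m) ⟨
      36 * Ws (suc (suc m)) + 150 * (suc (suc m) * suc (suc m) * suc (suc m))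
    ∎
    where
      A = Tp m (t (suc m))
      B = Ts m (t (suc m))
      expand₁ : ∀ W A m →
        25 * (W + (6 * A + 6 * suc m * 15) + 27) + 270 * (suc (suc m) * suc (suc m)) + 177 * suc (suc m)
          ≡ (25 * W + 270 * (suc m * suc m) + 177 * suc m) + 30 * (5 * A + 9) + (2790 * m + 3642)
      expand₁ = solve-∀
      expand₂ : ∀ V B m →
        (36 * V + 150 * (suc m * suc m * suc m)) + 30 * (6 * B + 15 * m * m + 6 * m) + (2790 * m + 3642)
          ≡ 36 * (V + (5 * B + (5 * m + 6) * 9) + 18) + 150 * (suc (suc m) * suc (suc m) * suc (suc m))
      expand₂ = solve-∀

lift : ∀ {n} → V n → Vℕ
lift (k , x) = toℕ k , x

module ChainWalks {n : ℕ} (c t : ℕ → Fin 6) (w : ℕ)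
    (E : V n → V n → Set) (E-sym : ∀ {a b} → E a b → E b a)
    (r : V n → V n) (hexEdge : ∀ {a b} → HexAdj a b → E (r a) (r b))
    (cutWalk : ∀ j (k k' : Fin n) → toℕ k ≡ j → toℕ k' ≡ suc j →
               Walk E w (r (k , t (suc j))) (r (k' , c (suc j))))
  where
  open ChainDistance c t w

  ascendingWalk : ∀ g (ki kj : Fin n) x y → toℕ ki + g ≡ toℕ kj →
                  Walk E (ascent (toℕ ki) x g y) (r (ki , x)) (r (kj , y))
  ascendingWalk zero ki kj x y e with toℕ-injective {i = ki} {j = kj} (trans (sym (+-identityʳ _)) e)
  ... | refl = mapWalk r hexEdge (hexWalk ki x y)
  ascendingWalk (suc g) ki kj x y e =
    ascendingWalk g ki km x (t (suc j)) (sym toℕ-km)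
      ++ʷ cutWalk j km kj toℕ-km toℕ-kj
      ++ʷ mapWalk r hexEdge (hexWalk kj (c (suc j)) y)
    where
      j = toℕ ki + g
      toℕ-kj : toℕ kj ≡ suc j
      toℕ-kj = trans (sym e) (+-suc (toℕ ki) g)
      km : Fin n
      km = fromℕ< (≤-trans (≤-reflexive (sym toℕ-kj)) (<⇒≤ (toℕ<n kj)))
      toℕ-km : toℕ km ≡ j
      toℕ-km = toℕ-fromℕ< _

  chainWalk : ∀ u v → Walk E (dist (lift u) (lift v)) (r u) (r v)
  chainWalk (ki , x) (kj , y) with ≤-total (toℕ ki) (toℕ kj)
  ... | inj₁ i≤j = castWalk (sym (dist-≤ x y i≤j)) refl refl
                     (ascendingWalk (toℕ kj ∸ toℕ ki) ki kj x y (m+[n∸m]≡n i≤j))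
  ... | inj₂ j≤i = castWalk (sym (dist-≥ x y j≤i)) refl refl
                     (reverseWalk E-sym (ascendingWalk (toℕ ki ∸ toℕ kj) kj ki y x (m+[n∸m]≡n j≤i)))

tabulate-toℕ : ∀ {A : Set} n (f : ℕ → A) → tabulate {n = n} (f ∘ toℕ) ≡ applyUpTo f n
tabulate-toℕ zero    f = refl
tabulate-toℕ (suc n) f = cong (f 0 ∷_) (tabulate-toℕ n (f ∘ suc))

lift-cartesian : ∀ {n} (ks : List (Fin n)) →
                 map lift (cartesianProduct ks (allFin 6)) ≡ concat (map (hexagon ∘ toℕ) ks)
lift-cartesian []       = refl
lift-cartesian (k ∷ ks) =
  trans (map-++ lift (map (k ,_) (allFin 6)) (cartesianProduct ks (allFin 6)))
        (cong₂ _++_ (sym (map-∘ {g = lift} {f = k ,_} (allFin 6))) (lift-cartesian ks))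

lift-allV : ∀ n → map lift (allV n) ≡ hexagons n
lift-allV n = trans (lift-cartesian (allFin n))
  (cong concat (trans (map-tabulate id (hexagon ∘ toℕ)) (tabulate-toℕ n hexagon)))

isRep-lift : ∀ {n} c t (a : V n) → isRep c t a ≡ survives c (lift a)
isRep-lift c t (zero  , x) = refl
isRep-lift c t (suc k , x) = refl

lift-squeezeV : ∀ n c t → map lift (squeezeV n c t) ≡ squeezed c n
lift-squeezeV n c t = trans (map-filterᵇ (isRep c t) (survives c) lift (isRep-lift c t) (allV n))
                            (cong (filterᵇ (survives c)) (lift-allV n))

module Polyphenyl {n : ℕ} (c t : ℕ → Fin 6) where
  open ChainDistance c t 1
  open ChainWiener c t using (Wp)

  PolyAdj-sym : ∀ {a b : V n} → PolyAdj c t a b → PolyAdj c t b a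
  PolyAdj-sym (inj₁ e)        = inj₁ (HexAdj-sym e)
  PolyAdj-sym (inj₂ (inj₁ e)) = inj₂ (inj₂ e)
  PolyAdj-sym (inj₂ (inj₂ e)) = inj₂ (inj₁ e)

  cutEdge : ∀ j (k k' : Fin n) → toℕ k ≡ j → toℕ k' ≡ suc j →
            Walk (PolyAdj c t) 1 (k , t (suc j)) (k' , c (suc j))
  cutEdge j k k' refl e = step (inj₂ (inj₁ (e , cong t (sym e) , cong c (sym e)))) here

  open ChainWalks c t 1 (PolyAdj c t) PolyAdj-sym id inj₁ cutEdge

  dist-lip : ∀ v {a b : V n} → PolyAdj c t a b → dist (lift a) v ≤ suc (dist (lift b) v)
  dist-lip v {k , _} (inj₁ (refl , adj)) = dist-hexLip (toℕ k) v adj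
  dist-lip v {k , _} {k' , _} (inj₂ (inj₁ (e , refl , refl))) rewrite e =
    differBy⇒≤ (dist-cut (toℕ k) v)
  dist-lip v {k , _} {k' , _} (inj₂ (inj₂ (e , refl , refl))) rewrite e =
    differBy⇒≤ (differBy-sym (dist-cut (toℕ k') v))

  polyphenyl-dist : ∀ {dbar} → IsShortestPathDist (λ _ → ⊤) (PolyAdj c t) dbar →
                    ∀ u v → dbar u v ≡ dist (lift u) (lift v)
  polyphenyl-dist sp u v = shortestPath≡ sp (λ a b → dist (lift a) (lift b))
    (λ a b _ _ → chainWalk a b) (λ a → dist-diag (lift a)) (λ b → dist-lip (lift b)) u v tt tt

  polyphenyl-wiener : ∀ {dbar} → IsShortestPathDist (λ _ → ⊤) (PolyAdj c t) dbar →
                      wiener dbar (allV n) ≡ Wp n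
  polyphenyl-wiener sp = begin
      wiener _ (allV n)
    ≡⟨ wiener-cong (polyphenyl-dist sp) (allV n) ⟩
      wiener (λ a b → dist (lift a) (lift b)) (allV n)
    ≡⟨ wiener-map dist lift (allV n) ⟨
      wiener dist (map lift (allV n))
    ≡⟨ cong (wiener dist) (lift-allV n) ⟩
      Wp n
    ∎

module Squeeze {n : ℕ} (c t : ℕ → Fin 6) (valid : ValidPolyphenyl n c t) where
  open ChainDistance c t 0
  open ChainWiener c t using (Ws)

  SqueezeAdj-sym : ∀ {a b : V n} → SqueezeAdj c t a b → SqueezeAdj c t b a
  SqueezeAdj-sym (a , b , e , ra , rb) = b , a , HexAdj-sym e , rb , ra

  rep-attached : ∀ {m} (k : Fin m) →
                 rep {suc m} c t (suc k , c (suc (toℕ k))) ≡ (inject₁ k , t (suc (toℕ k)))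
  rep-attached k with c (suc (toℕ k)) Fin.≟ c (suc (toℕ k))
  ... | yes _  = refl
  ... | no c≢c = contradiction refl c≢c

  rep-unattached : ∀ {m} (k : Fin m) x → ¬ x ≡ c (suc (toℕ k)) →
                   rep {suc m} c t (suc k , x) ≡ (suc k , x)
  rep-unattached k x x≢c with x Fin.≟ c (suc (toℕ k))
  ... | yes x≡c = contradiction x≡c x≢c
  ... | no  _   = refl

  rep-survivor : ∀ (v : V n) → IsRep c t v → rep c t v ≡ v
  rep-survivor (zero  , x) _ = refl
  rep-survivor (suc k , x) r with x Fin.≟ c (suc (toℕ k))
  rep-survivor (suc k , x) () | yes _
  ... | no _ = refl

  -- by validity, the vertex t of hexagon k ≥ 1 is not its attachment vertex
  rep-attachment : ∀ (k k' : Fin n) → toℕ k' ≡ suc (toℕ k) →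
                   rep c t (k , t (suc (toℕ k))) ≡ (k , t (suc (toℕ k)))
  rep-attachment zero     k' e = refl
  rep-attachment (suc k₀) k' e = rep-unattached k₀ _
    (valid (suc (suc (toℕ k₀))) (s≤s (s≤s z≤n)) (subst (λ i → suc i ≤ n) e (toℕ<n k')))

  rep-cut : ∀ (k k' : Fin n) → toℕ k' ≡ suc (toℕ k) →
            rep c t (k' , c (suc (toℕ k))) ≡ (k , t (suc (toℕ k)))
  rep-cut k (suc k'') e = begin
      rep c t (suc k'' , c (suc (toℕ k)))
    ≡⟨ cong (λ i → rep c t (suc k'' , c (suc i))) k''≡k ⟨
      rep c t (suc k'' , c (suc (toℕ k'')))
    ≡⟨ rep-attached k'' ⟩
      (inject₁ k'' , t (suc (toℕ k'')))
    ≡⟨ cong₂ _,_ (toℕ-injective (trans (toℕ-inject₁ k'') k''≡k)) (cong (λ i → t (suc i)) k''≡k) ⟩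
      (k , t (suc (toℕ k)))
    ∎
    where
      k''≡k : toℕ k'' ≡ toℕ k
      k''≡k = suc-injective e

  cutContracted : ∀ j (k k' : Fin n) → toℕ k ≡ j → toℕ k' ≡ suc j →
                  Walk (SqueezeAdj c t) 0 (rep c t (k , t (suc j))) (rep c t (k' , c (suc j)))
  cutContracted j k k' refl e =
    castWalk refl (sym (rep-attachment k k' e)) (sym (rep-cut k k' e)) here

  open ChainWalks c t 0 (SqueezeAdj c t) SqueezeAdj-sym
                  (rep c t) (λ {a} {b} e → a , b , e , refl , refl) cutContracted

  dist-rep : ∀ (a : V n) v → dist (lift (rep c t a)) v ≡ dist (lift a) v
  dist-rep (zero  , x) v = refl
  dist-rep (suc k , x) v with x Fin.≟ c (suc (toℕ k))
  ... | no  _    = refl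
  ... | yes refl rewrite toℕ-inject₁ k = differBy-zero (dist-cut (toℕ k) v)

  dist-lip : ∀ v {u u' : V n} → SqueezeAdj c t u u' → dist (lift u) v ≤ suc (dist (lift u') v)
  dist-lip v ((k , x) , (.k , x') , (refl , adj) , refl , refl)
    rewrite dist-rep (k , x) v | dist-rep (k , x') v = dist-hexLip (toℕ k) v adj

  squeeze-dist : ∀ {d} → IsShortestPathDist (IsRep c t) (SqueezeAdj c t) d →
                 ∀ u v → IsRep c t u → IsRep c t v → d u v ≡ dist (lift u) (lift v)
  squeeze-dist sp = shortestPath≡ sp (λ a b → dist (lift a) (lift b))
    (λ u v ru rv → castWalk refl (rep-survivor u ru) (rep-survivor v rv) (chainWalk u v))
    (λ a → dist-diag (lift a)) (λ b → dist-lip (lift b))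

  squeeze-wiener : ∀ {d} → IsShortestPathDist (IsRep c t) (SqueezeAdj c t) d →
                   wiener d (squeezeV n c t) ≡ Ws n
  squeeze-wiener sp = begin
      wiener _ (squeezeV n c t)
    ≡⟨ wiener-congˡ (All.map (Equivalence.to T-≡) (all-filter (T? ∘ isRep c t) (allV n)))
                    (λ {a} {b} → squeeze-dist sp a b) ⟩
      wiener (λ a b → dist (lift a) (lift b)) (squeezeV n c t)
    ≡⟨ wiener-map dist lift (squeezeV n c t) ⟨
      wiener dist (map lift (squeezeV n c t))
    ≡⟨ cong (wiener dist) (lift-squeezeV n c t) ⟩
      Ws n
    ∎

ℕ-identity-in-ℤ : ∀ {a b c d e} → a + d + e ≡ b + c →
                  ℤ.+ a ≡ ℤ.+ b ℤ.+ ℤ.+ c ℤ.- ℤ.+ d ℤ.- ℤ.+ e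
ℕ-identity-in-ℤ {a} {b} {c} {d} {e} eq = begin
    ℤ.+ a
  ≡⟨ cancel (ℤ.+ a) (ℤ.+ d) (ℤ.+ e) ⟩
    ℤ.+ a ℤ.+ ℤ.+ d ℤ.+ ℤ.+ e ℤ.- ℤ.+ d ℤ.- ℤ.+ e
  ≡⟨ cong (λ x → x ℤ.- ℤ.+ d ℤ.- ℤ.+ e) (trans (cong (ℤ._+ ℤ.+ e) (pos-+ a d)) (pos-+ (a + d) e)) ⟨
    ℤ.+ (a + d + e) ℤ.- ℤ.+ d ℤ.- ℤ.+ e
  ≡⟨ cong (λ x → ℤ.+ x ℤ.- ℤ.+ d ℤ.- ℤ.+ e) eq ⟩
    ℤ.+ (b + c) ℤ.- ℤ.+ d ℤ.- ℤ.+ e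
  ≡⟨ cong (λ x → x ℤ.- ℤ.+ d ℤ.- ℤ.+ e) (pos-+ b c) ⟩
    ℤ.+ b ℤ.+ ℤ.+ c ℤ.- ℤ.+ d ℤ.- ℤ.+ e
  ∎
  where
    cancel : ∀ x y z → x ≡ x ℤ.+ y ℤ.+ z ℤ.- y ℤ.- z
    cancel = ℤ-Ring.solve-∀

integer-form : ∀ n W̄ W → 25 * W̄ + 270 * (n * n) + 177 * n ≡ 36 * W + 150 * (n * n * n) →
  ℤ.+ 25 ℤ.* ℤ.+ W̄
    ≡ ℤ.+ 36 ℤ.* ℤ.+ W ℤ.+ ℤ.+ 150 ℤ.* ℤ.+ (n ^ 3) ℤ.- ℤ.+ 270 ℤ.* ℤ.+ (n ^ 2) ℤ.- ℤ.+ 177 ℤ.* ℤ.+ n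
integer-form n W̄ W eq = begin
    ℤ.+ 25 ℤ.* ℤ.+ W̄
  ≡⟨ pos-* 25 W̄ ⟨
    ℤ.+ (25 * W̄)
  ≡⟨ ℕ-identity-in-ℤ {25 * W̄} {36 * W} {150 * (n * n * n)} {270 * (n * n)} {177 * n} eq ⟩
    ℤ.+ (36 * W) ℤ.+ ℤ.+ (150 * (n * n * n)) ℤ.- ℤ.+ (270 * (n * n)) ℤ.- ℤ.+ (177 * n)
  ≡⟨ cong₂ ℤ._-_ (cong₂ ℤ._-_ (cong₂ ℤ._+_ (pos-* 36 W) (scaled 150 cube)) (scaled 270 square))
                 (pos-* 177 n) ⟩
    ℤ.+ 36 ℤ.* ℤ.+ W ℤ.+ ℤ.+ 150 ℤ.* ℤ.+ (n ^ 3) ℤ.- ℤ.+ 270 ℤ.* ℤ.+ (n ^ 2) ℤ.- ℤ.+ 177 ℤ.* ℤ.+ n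
  ∎
  where
    square : n * n ≡ n ^ 2
    square = cong (n *_) (sym (*-identityʳ n))
    cube : n * n * n ≡ n ^ 3
    cube = trans (*-assoc n n n) (cong (n *_) square)
    scaled : ∀ k {p q} → p ≡ q → ℤ.+ (k * p) ≡ ℤ.+ k ℤ.* ℤ.+ q
    scaled k {p} refl = pos-* k p

theorem4p1 : (n : ℕ) (c t : ℕ → Fin 6) → ValidPolyphenyl n c t →
    (dbar d : V n → V n → ℕ) →
    IsShortestPathDist (λ _ → ⊤) (PolyAdj c t) dbar →
    IsShortestPathDist (IsRep c t) (SqueezeAdj c t) d →
    ℤ.+ 25 ℤ.* ℤ.+ wiener dbar (allV n)
      ≡ ℤ.+ 36 ℤ.* ℤ.+ wiener d (squeezeV n c t) ℤ.+ ℤ.+ 150 ℤ.* ℤ.+ (n ^ 3)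
        ℤ.- ℤ.+ 270 ℤ.* ℤ.+ (n ^ 2) ℤ.- ℤ.+ 177 ℤ.* ℤ.+ n
theorem4p1 n c t valid dbar d dbar-isDist d-isDist
  rewrite Polyphenyl.polyphenyl-wiener c t dbar-isDist
        | Squeeze.squeeze-wiener c t valid d-isDist =
  integer-form n (Wp n) (Ws n) (wiener-identity n)
  where open ChainWiener c t using (Wp; Ws; wiener-identity)
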